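{- Let $P$ be a disjunctive normal program and $M$ an interpretation. Then $M$ is a model of $comp(P)$ if and only if $T3^{+}_P(M)=M$ and $T3^{ - }_P(M)=M$.
   Context: A disjunctive normal program $P$ consists of one clause per user-defined predicate $p$, of the form $p(V_1,\dots,V_n)\leftarrow (B_1\vee\dots\vee B_k)$, where $V_1,\dots,V_n$ are distinct variables (head variables) and each disjunct $B_j$ is a conjunction of equality atoms $V_1=T_1,\dots,V_n=T_n$ ($T_i$ terms) followed by user-defined atoms and negated user-defined atoms; other variables are local variables. The completion of a clause $H\leftarrow B$ is $H\leftarrow \exists W_1\cdots\exists W_m\, B$, where the $W_i$ are the local variables; $comp(P)$ is the set of completions. A head instance $H\theta\leftarrow B\theta$ replaces the head variables by ground terms (over the Herbrand universe). An interpretation maps each ground user-defined atom to $\mathbf{T}$ (true), $\mathbf{F}$ (false) or $\mathbf{I}$ (inadmissible); a ground equality atom $s=t$ is $\mathbf{T}$ iff $s,t$ are syntactically identical, else $\mathbf{F}$. Connectives: $\neg\mathbf{T}=\mathbf{F}$, $\neg\mathbf{F}=\mathbf{T}$, $\neg\mathbf{I}=\mathbf{I}$; $\wedge$ is $\mathbf{F}$ if some argument is $\mathbf{F}$, else $\mathbf{I}$ if some argument is $\mathbf{I}$, else $\mathbf{T}$; $\vee$ is $\mathbf{T}$ if some argument is $\mathbf{T}$, else $\mathbf{I}$ if some argument is $\mathbf{I}$, else $\mathbf{F}$; the existential closure $\exists(\varphi)$ is $\mathbf{T}$ if some ground instance of $\varphi$ is $\mathbf{T}$, $\mathbf{F}$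 if all ground instances are $\mathbf{F}$, and $\mathbf{I}$ otherwise. $M$ is a model of $comp(P)$ if for every clause $H\leftarrow B$ of $P$ and every head instance $H\theta\leftarrow B\theta$: if $H\theta$ is $\mathbf{T}$ then $\exists(B\theta)$ is $\mathbf{T}$, and if $H\theta$ is $\mathbf{F}$ then $\exists(B\theta)$ is $\mathbf{F}$. For a ground atom $A=H\theta$ let $v_M(A)$ denote the value of $\exists(B\theta)$ in $M$. $T3^{+}_P(M)$ is the interpretation in which $A$ is: inadmissible if $A$ is inadmissible in $M$; otherwise true if $v_M(A)$ is $\mathbf{T}$ or $\mathbf{I}$; false otherwise. $T3^{ - }_P(M)$ is the interpretation in which $A$ is: inadmissible if $A$ is inadmissible in $M$; otherwise true if $v_M(A)$ is $\mathbf{T}$; false otherwise. -}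

module Defs where

open import Data.Nat using (ℕ)
open import Data.Fin using (Fin)
open import Data.Sum using (_⊎_; inj₁; inj₂)
open import Data.Product using (Σ; _×_; _,_)
open import Data.List using (List; []; _∷_; map; _++_)
open import Data.Vec using (Vec; []; _∷_; lookup; toList)
open import Data.List.Relation.Binary.Pointwise using (Pointwise)
open import Relation.Binary.PropositionalEquality using (_≡_; _≢_)
open import Relation.Nullary using (¬_)
open import Data.Unit using (⊤)

data V3 : Set where
  T F I : V3

neg3 : V3 → V3
neg3 T = F
neg3 F = T
neg3 I = I

and3 : V3 → V3 → V3
and3 F _ = F
and3 _ F = F
and3 I _ = I
and3 _ I = I
and3 T T = T

or3 : V3 → V3 → V3
or3 T _ = T
or3 _ T = T
or3 I _ = I
or3 _ I = I
or3 F F = F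

andL : List V3 → V3
andL []       = T
andL (x ∷ xs) = and3 x (andL xs)

orL : List V3 → V3
orL []       = F
orL (x ∷ xs) = or3 x (orL xs)

-- Signature: function symbols (constants have arity 0) and
-- user-defined predicate symbols, with arities

record Signature : Set₁ where
  field
    Fun   : Set
    arity : Fun → ℕ
    Pred  : Set
    parity : Pred → ℕ

module Syntax (S : Signature) where
  open Signature S

  data Term (X : Set) : Set where
    var : X → Term X
    fn  : (f : Fun) → Vec (Term X) (arity f) → Term X

  data GTerm : Set where
    gfn : (f : Fun) → Vec GTerm (arity f) → GTerm

  GAtom : Set
  GAtom = Σ Pred (λ p → Vec GTerm (parity p))

  -- variables of a clause for a predicate of arity n:
  -- head variables V_1..V_n (distinct by construction) and local variables
  Var : ℕ → Set
  Var n = Fin n ⊎ ℕ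

  data Literal (X : Set) : Set where
    pos : (q : Pred) → Vec (Term X) (parity q) → Literal X
    neg : (q : Pred) → Vec (Term X) (parity q) → Literal X

  -- a disjunct  V_1 = T_1, ..., V_n = T_n, L_1, ..., L_r
  record Disjunct (n : ℕ) : Set where
    constructor disj
    field
      eqs  : Vec (Term (Var n)) n
      lits : List (Literal (Var n))

  Clause : Pred → Set
  Clause p = List (Disjunct (parity p))

  Program : Set
  Program = (p : Pred) → Clause p

  Interp : Set
  Interp = GAtom → V3

  module _ {n : ℕ} (θ : Vec GTerm n) (σ : ℕ → GTerm) where
    mutual
      inst : Term (Var n) → GTerm
      inst (var (inj₁ i)) = lookup θ i
      inst (var (inj₂ x)) = σ x
      inst (fn f ts)      = gfn f (instV ts)

      instV : ∀ {m} → Vec (Term (Var n)) m → Vec GTerm m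
      instV []       = []
      instV (t ∷ ts) = inst t ∷ instV ts

  data EqVal (s t : GTerm) : V3 → Set where
    eqT : s ≡ t → EqVal s t T
    eqF : s ≢ t → EqVal s t F

  module _ (M : Interp) {n : ℕ} (θ : Vec GTerm n) (σ : ℕ → GTerm) where

    litVal : Literal (Var n) → V3
    litVal (pos q ts) = M (q , instV θ σ ts)
    litVal (neg q ts) = neg3 (M (q , instV θ σ ts))

    EqVals : ∀ {m} → Vec GTerm m → Vec (Term (Var n)) m → Vec V3 m → Set
    EqVals []       []       []       = ⊤
    EqVals (s ∷ ss) (t ∷ ts) (v ∷ vs) = EqVal s (inst θ σ t) v × EqVals ss ts vs

    DisjVal : Disjunct n → V3 → Set
    DisjVal (disj es ls) v =
      Σ (Vec V3 n) λ evs → EqVals θ es evs × (v ≡ andL (toList evs ++ map litVal ls))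

    BodyVal : List (Disjunct n) → V3 → Set
    BodyVal ds v = Σ (List V3) λ vs → Pointwise DisjVal ds vs × (v ≡ orL vs)

  -- value of the existential closure ∃(Bθ) for the head instance p(θ):
  -- v_M(p(θ)) in the paper's notation.  Ground instances of Bθ are given
  -- by assignments σ of ground terms to the local variables.
  data ExVal (P : Program) (M : Interp) (p : Pred) (θ : Vec GTerm (parity p)) : V3 → Set where
    exT : Σ (ℕ → GTerm) (λ σ → BodyVal M θ σ (P p) T) → ExVal P M p θ T
    exF : (∀ σ → BodyVal M θ σ (P p) F) → ExVal P M p θ F
    exI : ¬ Σ (ℕ → GTerm) (λ σ → BodyVal M θ σ (P p) T)
        → ¬ (∀ σ → BodyVal M θ σ (P p) F)
        → ExVal P M p θ I

  IsModelComp : Program → Interp → Set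
  IsModelComp P M = ∀ p (θ : Vec GTerm (parity p)) →
    (M (p , θ) ≡ T → ExVal P M p θ T) × (M (p , θ) ≡ F → ExVal P M p θ F)

  -- pointwise operators: first argument = value of A in M, second = v_M(A)
  t3plus : V3 → V3 → V3
  t3plus I _ = I
  t3plus T T = T
  t3plus T I = T
  t3plus T F = F
  t3plus F T = T
  t3plus F I = T
  t3plus F F = F

  t3minus : V3 → V3 → V3
  t3minus I _ = I
  t3minus T T = T
  t3minus T _ = F
  t3minus F T = T
  t3minus F _ = F

  -- N = T3⁺_P(M)   (v_M(A) is the unique v with ExVal, so this is the graph
  -- of the operator)
  IsT3⁺ : Program → Interp → Interp → Set
  IsT3⁺ P M N = ∀ p (θ : Vec GTerm (parity p)) →
    Σ V3 λ v → ExVal P M p θ v × (N (p , θ) ≡ t3plus (M (p , θ)) v)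

  IsT3⁻ : Program → Interp → Interp → Set
  IsT3⁻ P M N = ∀ p (θ : Vec GTerm (parity p)) →
    Σ V3 λ v → ExVal P M p θ v × (N (p , θ) ≡ t3minus (M (p , θ)) v)

{-# OPTIONS --safe #-}
module Submission where

-- At an inadmissible atom both operators are the identity.  At a true atom
-- T3⁻ keeps the value exactly when v_M(A) = T, and at a false atom T3⁺ keeps
-- it exactly when v_M(A) = F; these are the two conditions defining a model
-- of comp(P), and each of them also makes the other operator keep the value.
-- Excluded middle is needed only to give v_M(A) a value at inadmissible atoms.

open import Defs
open import Level using (0ℓ)
open import Axiom.ExcludedMiddle using (ExcludedMiddle)
open import Data.Nat using (ℕ)
open import Data.Product using (Σ; _×_; _,_; proj₁; proj₂)
open import Function.Bundles using (_⇔_; mk⇔)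
open import Relation.Nullary using (yes; no)
open import Relation.Binary.PropositionalEquality using (_≡_; refl; subst)

data Agree : V3 → V3 → Set where
  T-T   : Agree T T
  F-F   : Agree F F
  I-any : ∀ {v} → Agree I v

module _ (S : Signature) where
  open Syntax S

  agree⇒t3plus-fixed : ∀ {m v} → Agree m v → m ≡ t3plus m v
  agree⇒t3plus-fixed T-T   = refl
  agree⇒t3plus-fixed F-F   = refl
  agree⇒t3plus-fixed I-any = refl

  agree⇒t3minus-fixed : ∀ {m v} → Agree m v → m ≡ t3minus m v
  agree⇒t3minus-fixed T-T   = refl
  agree⇒t3minus-fixed F-F   = refl
  agree⇒t3minus-fixed I-any = refl

  t3minus-fixes-T⇒T : ∀ {m v} → m ≡ T → m ≡ t3minus m v → v ≡ T
  t3minus-fixes-T⇒T {v = T} refl refl = refl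
  t3minus-fixes-T⇒T {v = F} refl ()
  t3minus-fixes-T⇒T {v = I} refl ()

  t3plus-fixes-F⇒F : ∀ {m v} → m ≡ F → m ≡ t3plus m v → v ≡ F
  t3plus-fixes-F⇒F {v = T} refl ()
  t3plus-fixes-F⇒F {v = F} refl refl = refl
  t3plus-fixes-F⇒F {v = I} refl ()

  exVal-total : ExcludedMiddle 0ℓ → ∀ P M p θ → Σ V3 (ExVal P M p θ)
  exVal-total lem P M p θ with lem {Σ (ℕ → GTerm) λ σ → BodyVal M θ σ (P p) T}
  ... | yes someT = T , exT someT
  ... | no noT with lem {∀ σ → BodyVal M θ σ (P p) F}
  ...   | yes allF = F , exF allF
  ...   | no notAllF = I , exI noT notAllF

  model⇒agreeing-exVal : ExcludedMiddle 0ℓ → ∀ {P M} → IsModelComp P M →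
    ∀ p θ → Σ V3 λ v → ExVal P M p θ v × Agree (M (p , θ)) v
  model⇒agreeing-exVal lem {P} {M} model p θ with M (p , θ) in eq
  ... | T = T , proj₁ (model p θ) eq , T-T
  ... | F = F , proj₂ (model p θ) eq , F-F
  ... | I = let v , exVal = exVal-total lem P M p θ in v , exVal , I-any

  model⇒fixpoint : ExcludedMiddle 0ℓ → ∀ {P M} → IsModelComp P M →
    IsT3⁺ P M M × IsT3⁻ P M M
  model⇒fixpoint lem {P} {M} model = plus , minus
    where
    plus : IsT3⁺ P M M
    plus p θ = let v , exVal , agree = model⇒agreeing-exVal lem model p θ
               in v , exVal , agree⇒t3plus-fixed agree
    minus : IsT3⁻ P M M
    minus p θ = let v , exVal , agree = model⇒agreeing-exVal lem model p θ
                in v , exVal , agree⇒t3minus-fixed agree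

  fixpoint⇒model : ∀ {P M} → IsT3⁺ P M M × IsT3⁻ P M M → IsModelComp P M
  fixpoint⇒model {P} {M} (plus , minus) p θ = whenT , whenF
    where
    whenT : M (p , θ) ≡ T → ExVal P M p θ T
    whenT isT = let v , exVal , fixed = minus p θ
                in subst (ExVal P M p θ) (t3minus-fixes-T⇒T isT fixed) exVal
    whenF : M (p , θ) ≡ F → ExVal P M p θ F
    whenF isF = let v , exVal , fixed = plus p θ
                in subst (ExVal P M p θ) (t3plus-fixes-F⇒F isF fixed) exVal

mainTheorem9 : ExcludedMiddle 0ℓ → (S : Signature) → let open Syntax S in
    (P : Program) (M : Interp) →
    IsModelComp P M ⇔ (IsT3⁺ P M M × IsT3⁻ P M M)
mainTheorem9 lem S P M = mk⇔ (model⇒fixpoint S lem) (fixpoint⇒model S)
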